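{- Let $G$ be an equatorial graph with equator $q$. Then every vertex of $G$ lies on some isometric cycle of $G$ of length $q$.
   Context: A cycle $C$ is isometric if $d_C(x,y)=d_G(x,y)$ for all $x,y\in V(C)$; the equator is the length of a longest isometric cycle. For $\delta\ge2$, $g\ge3$, $k=\lceil g/2\rceil-1$, the Moore bound is $M(\delta,g)=1+\sum_{i=0}^{k-1}\delta(\delta-1)^i$ for odd $g$ and $M(\delta,g)=2+\sum_{i=1}^{k}2(\delta-1)^i$ for even $g$. An equatorial graph is a finite graph with girth $g$, minimum degree $\delta$ and equator $q>6k+3$ (with $k=\lceil g/2\rceil-1$) whose order is exactly $\frac{q}{g}M(\delta,g)$. -}

module Defs where

open import Data.Nat using (ℕ; zero; suc; _+_; _*_; _∸_; _^_; _≤_; _<_; _⊓_; ∣_-_∣; _/_)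
open import Data.Fin using (Fin; toℕ)
open import Data.Bool using (Bool; true; false; T; if_then_else_)
open import Data.List using (List; map; allFin)
open import Data.Nat.ListAction using (sum)
open import Data.Product using (Σ; ∃; _×_)
open import Relation.Binary.PropositionalEquality using (_≡_)
open import Function.Definitions using (Injective)

record Graph : Set where
  field
    n     : ℕ
    adj   : Fin n → Fin n → Bool
    sym   : ∀ x y → adj x y ≡ adj y x
    irref : ∀ x → adj x x ≡ false

open Graph public

V : Graph → Set
V G = Fin (n G)

Adj : (G : Graph) → V G → V G → Set
Adj G x y = T (adj G x y)

deg : (G : Graph) → V G → ℕ
deg G v = sum (map (λ u → if adj G v u then 1 else 0) (allFin (n G)))

MinDegree : Graph → ℕ → Set
MinDegree G δ = (∃ λ v → deg G v ≡ δ) × (∀ v → δ ≤ deg G v)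

data Walk (G : Graph) : V G → V G → ℕ → Set where
  nil  : ∀ {x} → Walk G x x 0
  cons : ∀ {x y z l} → Adj G x y → Walk G y z l → Walk G x z (suc l)

Dist : (G : Graph) → V G → V G → ℕ → Set
Dist G x y d = Walk G x y d × (∀ l → Walk G x y l → d ≤ l)

record Cycle (G : Graph) (m : ℕ) : Set where
  field
    len≥3 : 3 ≤ m
    vtx   : Fin m → V G
    inj   : Injective _≡_ _≡_ vtx
    step  : ∀ (i j : Fin m) → suc (toℕ i) ≡ toℕ j → Adj G (vtx i) (vtx j)
    close : ∀ (i j : Fin m) → suc (toℕ i) ≡ m → toℕ j ≡ 0 → Adj G (vtx i) (vtx j)

open Cycle public

cycDist : (m : ℕ) → Fin m → Fin m → ℕ
cycDist m i j = ∣ toℕ i - toℕ j ∣ ⊓ (m ∸ ∣ toℕ i - toℕ j ∣)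

Isometric : {G : Graph} {m : ℕ} → Cycle G m → Set
Isometric {G} {m} C = ∀ (i j : Fin m) → Dist G (vtx C i) (vtx C j) (cycDist m i j)

Girth : Graph → ℕ → Set
Girth G g = Cycle G g × (∀ m → Cycle G m → g ≤ m)

Equator : Graph → ℕ → Set
Equator G q = (Σ (Cycle G q) Isometric) × (∀ m → (C : Cycle G m) → Isometric C → m ≤ q)

-- k = ⌈g/2⌉ - 1 = ⌊(g-1)/2⌋
kOf : ℕ → ℕ
kOf g = (g ∸ 1) / 2

sumFrom : ℕ → ℕ → (ℕ → ℕ) → ℕ
sumFrom a zero    f = 0
sumFrom a (suc c) f = f a + sumFrom (suc a) c f


odd : ℕ → Bool
odd zero          = false
odd (suc zero)    = true
odd (suc (suc g)) = odd g

Moore : ℕ → ℕ → ℕ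
Moore δ g =
  if odd g
  then 1 + sumFrom 0 (kOf g) (λ i → δ * (δ ∸ 1) ^ i)
  else 2 + sumFrom 1 (kOf g) (λ i → 2 * (δ ∸ 1) ^ i)

-- equatorial graph: girth g, min degree δ, equator q > 6k+3,
-- order = (q/g) M(δ,g), i.e. g * |V| = q * M(δ,g)
record Equatorial (G : Graph) (δ g q : ℕ) : Set where
  field
    δ≥2   : 2 ≤ δ
    g≥3   : 3 ≤ g
    girth : Girth G g
    mindeg : MinDegree G δ
    equator : Equator G q
    q-big : 6 * kOf g + 3 < q
    order : g * n G ≡ q * Moore δ g

-- Let C be an equator, of length q, and k = ⌈g/2⌉ - 1.  Call a vertex w antipodal if two
-- positions of C at cyclic distance 2k both lie within distance k of w.  Count the pairs (w, i)
-- with w within k of the i-th vertex of C (g odd) or of the i-th edge of C (g even).  Each i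
-- accounts for at least M(δ, g) vertices by the Moore bound.  For a fixed w the positions i
-- are pairwise within E = 2k (resp. 2k + 1) on C, and within E - 1 unless w is antipodal; as
-- 3E < q such positions lie in an arc, so there are at most E + 1 = g of them, and fewer unless
-- w is antipodal.  As g |V| = q M(δ, g), every vertex is antipodal.
--
-- Positions b, b + 2k witnessing this are an anchor of w.  Again because q > 6k + 3, adjacent
-- vertices have anchors at cyclic distance at most 1, so anchors are 1-Lipschitz from G to C.
-- For a vertex v with anchor b, the walk from C(b) through v to C(b + 2k) is a geodesic of
-- length 2k.  Splicing it into C in place of the arc from b to b + 2k gives a q-cycle through v
-- whose i-th vertex has anchor b - k + i, and the Lipschitz property makes it isometric.

module Submission where

open import Defs hiding (sym)

open import Data.Bool using (Bool; true; false; T; if_then_else_; _∧_; _∨_; not)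
open import Data.Bool.Properties using (∧-identityʳ; ∧-zeroʳ; T-∧; T-∨)
open import Data.Fin using (Fin; zero; suc; toℕ; fromℕ<)
import Data.Fin.Properties as Finₚ
open import Data.List using (List; []; _∷_; _++_; map; length; tabulate; concatMap)
open import Data.List.Properties using (length-map; length-++)
open import Data.List.Membership.Propositional using (_∈_; find)
open import Data.List.Membership.Propositional.Properties using (∈-map⁻; ∈-concatMap⁻; ∈-++⁻)
open import Data.List.Relation.Binary.Disjoint.Propositional using (Disjoint)
open import Data.List.Relation.Unary.All as All using (All; []; _∷_)
open import Data.List.Relation.Unary.All.Properties using () renaming (map⁺ to All-map⁺)
open import Data.List.Relation.Unary.Any using (here; there)
open import Data.List.Relation.Unary.Unique.Propositional using (Unique; []; _∷_)
open import Data.List.Relation.Unary.Unique.Propositional.Properties using () renaming (map⁺ to Unique-map⁺; ++⁺ to Unique-++⁺)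
open import Data.Nat using (ℕ; zero; suc; pred; _+_; _*_; _∸_; _⊓_; _%_; _^_; _≤_; _<_; z≤n; s≤s; NonZero; >-nonZero; >-nonZero⁻¹; _<?_; ∣_-_∣)
open import Data.Nat.DivMod using (_mod_; %-distribˡ-+; [m+n]%n≡m%n; m%n%n≡m%n; m<n⇒m%n≡m; m%n<n; n%n≡0; m/n≡1+[m∸n]/n)
open import Data.Nat.ListAction using (sum)
open import Data.Nat.Properties
open import Data.Nat.Tactic.RingSolver using (solve-∀)
open import Data.Product using (Σ; _,_; _×_; ∃; ∃-syntax; Σ-syntax; proj₁; proj₂)
open import Data.Sum as Sum using (_⊎_; inj₁; inj₂; [_,_]′)
open import Data.Unit using (tt)
open import Function using (_∘_; id)
open import Function.Bundles using (Equivalence)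
open import Relation.Binary.Definitions using (tri<; tri≈; tri>)
open import Relation.Binary.PropositionalEquality using (_≡_; _≢_; refl; sym; trans; cong; cong₂; subst; subst₂; module ≡-Reasoning)
open import Relation.Nullary using (Dec; does; yes; no; ¬_; contradiction)
open import Relation.Nullary.Decidable using (map′; T?; _⊎-dec_; _×-dec_; isYes; toWitness; fromWitness)

open import Algebra.Properties.CommutativeMonoid.Sum +-0-commutativeMonoid using (sum-syntax; sum-cong-≗; ∑-comm)
open import Algebra.Properties.CommutativeSemigroup +-commutativeSemigroup using (x∙yz≈y∙xz; xy∙z≈xz∙y; xy∙z≈y∙xz)

-- Counting and bounded search

⟦_⟧ : Bool → ℕ
⟦ b ⟧ = if b then 1 else 0

count : ∀ {n} → (Fin n → Bool) → ℕ
count {n} P = ∑[ i < n ] ⟦ P i ⟧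

_==_ : ∀ {n} → Fin n → Fin n → Bool
i == j = does (i Finₚ.≟ j)

≢⇒¬== : ∀ {n} {i j : Fin n} → i ≢ j → T (not (i == j))
≢⇒¬== {i = i} {j} i≢j with i Finₚ.≟ j
... | yes i≡j = contradiction i≡j i≢j
... | no  _   = tt

¬==⇒≢ : ∀ {n} {i j : Fin n} → T (not (i == j)) → i ≢ j
¬==⇒≢ {i = i} {j} ¬i==j with i Finₚ.≟ j
... | no i≢j = i≢j

∑-const : ∀ n c → ∑[ i < n ] c ≡ n * c
∑-const zero    c = refl
∑-const (suc n) c = cong (c +_) (∑-const n c)

∑-mono-≤ : ∀ {n} {f h : Fin n → ℕ} → (∀ i → f i ≤ h i) → ∑[ i < n ] f i ≤ ∑[ i < n ] h i
∑-mono-≤ {zero}  f≤h = z≤n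
∑-mono-≤ {suc n} f≤h = +-mono-≤ (f≤h zero) (∑-mono-≤ (f≤h ∘ suc))

∑-mono-< : ∀ {n} {f h : Fin n → ℕ} → (∀ i → f i ≤ h i) → ∀ j → f j < h j →
           ∑[ i < n ] f i < ∑[ i < n ] h i
∑-mono-< {suc n} f≤h zero    fj<hj = +-mono-<-≤ fj<hj (∑-mono-≤ (f≤h ∘ suc))
∑-mono-< {suc n} f≤h (suc j) fj<hj = +-mono-≤-< (f≤h zero) (∑-mono-< (f≤h ∘ suc) j fj<hj)

count-remove : ∀ {n} (P : Fin n → Bool) z → count P ≡ ⟦ P z ⟧ + count (λ w → P w ∧ not (w == z))
count-remove {suc n} P zero = cong (⟦ P zero ⟧ +_) (sym (cong₂ _+_
  (cong ⟦_⟧ (∧-zeroʳ (P zero))) (sum-cong-≗ (λ w → cong ⟦_⟧ (∧-identityʳ (P (suc w)))))))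
count-remove {suc n} P (suc z) = begin
  ⟦ P zero ⟧ + count (P ∘ suc)                  ≡⟨ cong (⟦ P zero ⟧ +_) (count-remove (P ∘ suc) z) ⟩
  ⟦ P zero ⟧ + (⟦ P (suc z) ⟧ + count P∖z)      ≡⟨ x∙yz≈y∙xz ⟦ P zero ⟧ ⟦ P (suc z) ⟧ (count P∖z) ⟩
  ⟦ P (suc z) ⟧ + (⟦ P zero ⟧ + count P∖z)      ≡⟨ cong (λ b → ⟦ P (suc z) ⟧ + (⟦ b ⟧ + count P∖z)) (∧-identityʳ (P zero)) ⟨
  ⟦ P (suc z) ⟧ + (⟦ P zero ∧ true ⟧ + count P∖z) ∎
  where
  open ≡-Reasoning
  P∖z : Fin n → Bool
  P∖z w = P (suc w) ∧ not (w == z)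

count-none : ∀ {n} (P : Fin n → Bool) → (∀ i → ¬ T (P i)) → count P ≡ 0
count-none {zero}  P none = refl
count-none {suc n} P none with P zero | none zero
... | false | _  = count-none (P ∘ suc) (none ∘ suc)
... | true  | ¬T = contradiction tt ¬T

length≤count : ∀ {n} (P : Fin n → Bool) {L} → Unique L → All (T ∘ P) L → length L ≤ count P
length≤count P {[]}    []         []         = z≤n
length≤count P {z ∷ L} (z∉L ∷ uL) (Pz ∷ PL) = begin
  suc (length L)                         ≤⟨ s≤s (length≤count P∖z uL (P∖z-holds z∉L PL)) ⟩
  suc (count P∖z)                        ≡⟨ cong (_+ count P∖z) (T⇒⟦⟧≡1 Pz) ⟨
  ⟦ P z ⟧ + count P∖z                    ≡⟨ count-remove P z ⟨
  count P                                ∎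
  where
  open ≤-Reasoning
  P∖z : _ → Bool
  P∖z w = P w ∧ not (w == z)
  T⇒⟦⟧≡1 : ∀ {b} → T b → ⟦ b ⟧ ≡ 1
  T⇒⟦⟧≡1 {true} _ = refl
  P∖z-holds : ∀ {L} → All (z ≢_) L → All (T ∘ P) L → All (T ∘ P∖z) L
  P∖z-holds []           []         = []
  P∖z-holds (z≢w ∷ z≢L) (Pw ∷ PL) = Equivalence.from T-∧ (Pw , ≢⇒¬== (z≢w ∘ sym)) ∷ P∖z-holds z≢L PL

double-counting : ∀ {n m g M} (B : Fin n → Fin m → Bool) → g * n ≡ m * M →
                  (∀ j → M ≤ count (λ i → B i j)) → (∀ i → count (B i) ≤ g) → ∀ i → g ≤ count (B i)
double-counting {n} {m} {g} {M} B gn≡mM column row i = ≮⇒≥ λ row<g → <-irrefl refl (begin-strict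
  g * n                           ≡⟨ gn≡mM ⟩
  m * M                           ≡⟨ ∑-const m M ⟨
  ∑[ j < m ] M                    ≤⟨ ∑-mono-≤ column ⟩
  ∑[ j < m ] count (λ i → B i j)  ≡⟨ ∑-comm (λ i j → ⟦ B i j ⟧) ⟨
  ∑[ i < n ] count (B i)          <⟨ ∑-mono-< row i row<g ⟩
  ∑[ i < n ] g                    ≡⟨ ∑-const n g ⟩
  n * g                           ≡⟨ *-comm n g ⟩
  g * n                           ∎)
  where open ≤-Reasoning

elems : ∀ {n} → (Fin n → Bool) → List (Fin n)
elems {zero}  P = []
elems {suc n} P = if P zero then zero ∷ map suc (elems (P ∘ suc)) else map suc (elems (P ∘ suc))

∈-elems⁻ : ∀ {n} (P : Fin n → Bool) {x} → x ∈ elems P → T (P x)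
∈-elems⁻ {suc n} P x∈ with P zero in P0
∈-elems⁻ {suc n} P (here refl) | true  = subst T (sym P0) tt
∈-elems⁻ {suc n} P (there x∈)  | true  with _ , y∈ , refl ← ∈-map⁻ suc x∈ = ∈-elems⁻ (P ∘ suc) y∈
∈-elems⁻ {suc n} P x∈          | false with _ , y∈ , refl ← ∈-map⁻ suc x∈ = ∈-elems⁻ (P ∘ suc) y∈

elems-unique : ∀ {n} (P : Fin n → Bool) → Unique (elems P)
elems-unique {zero}  P = []
elems-unique {suc n} P with P zero
... | true  = All-map⁺ (All.tabulate (λ _ ())) ∷ Unique-map⁺ Finₚ.suc-injective (elems-unique (P ∘ suc))
... | false = Unique-map⁺ Finₚ.suc-injective (elems-unique (P ∘ suc))

length-elems : ∀ {n} (P : Fin n → Bool) → length (elems P) ≡ count P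
length-elems {zero}  P = refl
length-elems {suc n} P with P zero
... | true  = cong suc (trans (length-map suc (elems (P ∘ suc))) (length-elems (P ∘ suc)))
... | false = trans (length-map suc (elems (P ∘ suc))) (length-elems (P ∘ suc))

Unique-map-on : ∀ {A B : Set} (f : A → B) {Q : A → Set} → (∀ {x y} → Q x → Q y → f x ≡ f y → x ≡ y) →
                ∀ {xs} → All Q xs → Unique xs → Unique (map f xs)
Unique-map-on f inj []         []         = []
Unique-map-on f inj (Qx ∷ Qxs) (x∉ ∷ uxs) =
  All-map⁺ (All.zipWith (λ (Qy , x≢y) → x≢y ∘ inj Qx Qy) (Qxs , x∉)) ∷ Unique-map-on f inj Qxs uxs

sum-map-tabulate : ∀ {A : Set} {n} (f : A → ℕ) (h : Fin n → A) → sum (map f (tabulate h)) ≡ ∑[ i < n ] f (h i)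
sum-map-tabulate {n = zero}  f h = refl
sum-map-tabulate {n = suc n} f h = cong (f (h zero) +_) (sum-map-tabulate f (h ∘ suc))

sumFrom-*ˡ : ∀ r a c (h : ℕ → ℕ) → sumFrom a c (λ i → r * h i) ≡ r * sumFrom a c h
sumFrom-*ˡ r a zero    h = sym (*-zeroʳ r)
sumFrom-*ˡ r a (suc c) h = trans (cong (r * h a +_) (sumFrom-*ˡ r (suc a) c h)) (sym (*-distribˡ-+ r (h a) _))

sumFrom-^-suc : ∀ r a c → sumFrom (suc a) c (r ^_) ≡ r * sumFrom a c (r ^_)
sumFrom-^-suc r a c = trans (shift a c) (sumFrom-*ˡ r a c (r ^_))
  where
  shift : ∀ a c → sumFrom (suc a) c (r ^_) ≡ sumFrom a c (λ i → r * r ^ i)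
  shift a zero    = refl
  shift a (suc c) = cong (r * r ^ a +_) (shift (suc a) c)

length-concatMap-≥ : ∀ {A B : Set} (f : A → List B) m → (∀ x → m ≤ length (f x)) →
                     ∀ xs → length xs * m ≤ length (concatMap f xs)
length-concatMap-≥ f m m≤ []       = z≤n
length-concatMap-≥ f m m≤ (x ∷ xs) =
  subst (m + length xs * m ≤_) (sym (length-++ (f x))) (+-mono-≤ (m≤ x) (length-concatMap-≥ f m m≤ xs))

Unique-concatMap : ∀ {A B : Set} (f : A → List B) {xs} → Unique xs → (∀ {x} → x ∈ xs → Unique (f x)) →
                   (∀ {x y} → x ∈ xs → y ∈ xs → x ≢ y → Disjoint (f x) (f y)) → Unique (concatMap f xs)
Unique-concatMap f {[]}     _           _      _    = []
Unique-concatMap f {x ∷ xs} (x∉ ∷ uxs) unique disj =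
  Unique-++⁺ (unique (here refl)) (Unique-concatMap f uxs (unique ∘ there) (λ x∈ y∈ → disj (there x∈) (there y∈)))
    (λ (z∈fx , z∈rest) → let y , y∈ , z∈fy = find (∈-concatMap⁻ f z∈rest)
                          in disj (here refl) (there y∈) (All.lookup x∉ y∈) (z∈fx , z∈fy))

minimal? : {P : ℕ → Set} → (∀ a → Dec (P a)) → ∀ n →
           (∃[ a ] a < n × P a × (∀ c → c < a → ¬ P c)) ⊎ (∀ c → c < n → ¬ P c)
minimal? P? zero = inj₂ (λ _ ())
minimal? P? (suc n) with minimal? P? n
... | inj₁ (a , a<n , Pa , min) = inj₁ (a , m<n⇒m<1+n a<n , Pa , min)
... | inj₂ none with P? n
...   | yes Pn = inj₁ (n , ≤-refl , Pn , none)
...   | no ¬Pn = inj₂ (λ c c<1+n → [ none c , (λ { refl → ¬Pn }) ]′ (m<1+n⇒m<n∨m≡n c<1+n))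

least : {P : ℕ → Set} → (∀ a → Dec (P a)) → ∀ {b} → P b → ∃[ a ] a ≤ b × P a × (∀ c → c < a → ¬ P c)
least P? {b} Pb with minimal? P? (suc b)
... | inj₁ (a , a<1+b , Pa , min) = a , ≤-pred a<1+b , Pa , min
... | inj₂ none                   = contradiction Pb (none b ≤-refl)

exists-below? : {P : ℕ → Set} → (∀ a → Dec (P a)) → ∀ n → Dec (∃[ a ] a < n × P a)
exists-below? P? n with minimal? P? n
... | inj₁ (a , a<n , Pa , _) = yes (a , a<n , Pa)
... | inj₂ none               = no (λ (a , a<n , Pa) → none a a<n Pa)

∸≤⇒≤+ : ∀ {m n o} → m ∸ n ≤ o → m ≤ n + o
∸≤⇒≤+ {m} {n} m∸n≤o = ≤-trans (m≤n+m∸n m n) (+-monoʳ-≤ n m∸n≤o)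

short-arc : ∀ {q d E} → d ⊓ (q ∸ d) ≤ E → d ≤ E ⊎ q ≤ d + E
short-arc {q} {d} {E} h with ⊓-sel d (q ∸ d)
... | inj₁ ≡d   = inj₁ (subst (_≤ E) ≡d h)
... | inj₂ ≡q∸d = inj₂ (∸≤⇒≤+ (subst (_≤ E) ≡q∸d h))

-- Walks and girth

module Walks (G : Graph) where

  adj-sym : ∀ {x y} → Adj G x y → Adj G y x
  adj-sym {x} {y} = subst T (Graph.sym G x y)

  adj-irrefl : ∀ {x} → ¬ Adj G x x
  adj-irrefl {x} = subst T (Graph.irref G x)

  infixr 5 _++ʷ_
  _++ʷ_ : ∀ {x y z l m} → Walk G x y l → Walk G y z m → Walk G x z (l + m)
  nil      ++ʷ w = w
  cons a p ++ʷ w = cons a (p ++ʷ w)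

  snocʷ : ∀ {x y z l} → Walk G x y l → Adj G y z → Walk G x z (suc l)
  snocʷ nil        a = cons a nil
  snocʷ (cons b p) a = cons b (snocʷ p a)

  reverseʷ : ∀ {x y l} → Walk G x y l → Walk G y x l
  reverseʷ nil        = nil
  reverseʷ (cons a p) = snocʷ (reverseʷ p) (adj-sym a)

  Near : V G → V G → ℕ → Set
  Near x y k = ∃[ l ] l ≤ k × Walk G x y l

  near-refl : ∀ {x k} → Near x x k
  near-refl = 0 , z≤n , nil

  near-sym : ∀ {x y k} → Near x y k → Near y x k
  near-sym (l , l≤k , w) = l , l≤k , reverseʷ w

  near-trans : ∀ {x y z k m} → Near x y k → Near y z m → Near x z (k + m)
  near-trans (l , l≤k , w) (l′ , l′≤m , w′) = l + l′ , +-mono-≤ l≤k l′≤m , w ++ʷ w′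

  near-weaken : ∀ {x y k m} → k ≤ m → Near x y k → Near x y m
  near-weaken k≤m (l , l≤k , w) = l , ≤-trans l≤k k≤m , w

  Dist⇒Near : ∀ {x y d} → Dist G x y d → Near x y d
  Dist⇒Near (w , _) = _ , ≤-refl , w

  Dist≤Near : ∀ {x y d k} → Dist G x y d → Near x y k → d ≤ k
  Dist≤Near (_ , shortest) (l , l≤k , w) = ≤-trans (shortest l w) l≤k

  near? : ∀ x y k → Dec (Near x y k)
  near? x y zero = map′ (λ { refl → near-refl }) (λ { (0 , _ , nil) → refl }) (x Finₚ.≟ y)
  near? x y (suc k) = map′ to from (x Finₚ.≟ y ⊎-dec Finₚ.any? (λ u → T? (adj G x u) ×-dec near? u y k))
    where
    to : x ≡ y ⊎ ∃[ u ] Adj G x u × Near u y k → Near x y (suc k)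
    to (inj₁ refl)                 = near-refl
    to (inj₂ (_ , a , l , l≤k , w)) = suc l , s≤s l≤k , cons a w
    from : Near x y (suc k) → x ≡ y ⊎ ∃[ u ] Adj G x u × Near u y k
    from (0     , _         , nil)      = inj₁ refl
    from (suc l , s≤s l≤k , cons a w) = inj₂ (_ , a , l , l≤k , w)

  vertexAt : ∀ {x y l} → Walk G x y l → ℕ → V G
  vertexAt (nil {x})      _       = x
  vertexAt (cons {x} _ _) zero    = x
  vertexAt (cons _ w)     (suc i) = vertexAt w i

  vertexAt-start : ∀ {x y l} (w : Walk G x y l) → vertexAt w 0 ≡ x
  vertexAt-start nil        = refl
  vertexAt-start (cons _ _) = refl

  vertexAt-end : ∀ {x y l} (w : Walk G x y l) → vertexAt w l ≡ y
  vertexAt-end nil                 = refl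
  vertexAt-end (cons _ nil)        = refl
  vertexAt-end (cons _ (cons a w)) = vertexAt-end (cons a w)

  vertexAt-++ : ∀ {x y z l m} (p : Walk G x y l) (w : Walk G y z m) → vertexAt (p ++ʷ w) l ≡ y
  vertexAt-++ nil        w = vertexAt-start w
  vertexAt-++ (cons _ p) w = vertexAt-++ p w

  vertexAt-adj : ∀ {x y l} (w : Walk G x y l) i → i < l → Adj G (vertexAt w i) (vertexAt w (suc i))
  vertexAt-adj (cons a w) zero    _         = subst (Adj G _) (sym (vertexAt-start w)) a
  vertexAt-adj (cons _ w) (suc i) (s≤s i<l) = vertexAt-adj w i i<l

  takeʷ : ∀ {x y l} (w : Walk G x y l) s → s ≤ l → Walk G x (vertexAt w s) s
  takeʷ nil        zero    _         = nil
  takeʷ (cons _ _) zero    _         = nil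
  takeʷ (cons a w) (suc s) (s≤s s≤l) = cons a (takeʷ w s s≤l)

  dropʷ : ∀ {x y l} (w : Walk G x y l) s → s ≤ l → Walk G (vertexAt w s) y (l ∸ s)
  dropʷ nil        zero    _         = nil
  dropʷ (cons a w) zero    _         = cons a w
  dropʷ (cons _ w) (suc s) (s≤s s≤l) = dropʷ w s s≤l

  record NonBacktracking (L : ℕ) (f : ℕ → V G) : Set where
    field
      adjacent  : ∀ i → i < L → Adj G (f i) (f (suc i))
      no-return : ∀ i → 2 + i ≤ L → f i ≢ f (2 + i)
  open NonBacktracking

  infixr 5 _◂_
  _◂_ : V G → (ℕ → V G) → ℕ → V G
  (a ◂ f) zero    = a
  (a ◂ f) (suc i) = f i

  nb-[] : ∀ {f} → NonBacktracking 0 f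
  nb-[] = record { adjacent = λ _ () ; no-return = λ _ () }

  nb-∷ : ∀ {L f a} → Adj G a (f 0) → (1 ≤ L → a ≢ f 1) → NonBacktracking L f → NonBacktracking (suc L) (a ◂ f)
  adjacent  (nb-∷ a _ N) zero    _           = a
  adjacent  (nb-∷ _ _ N) (suc i) (s≤s i<L)   = adjacent N i i<L
  no-return (nb-∷ _ a≢ _) zero    (s≤s 1≤L)  = a≢ 1≤L
  no-return (nb-∷ _ _ N) (suc i) (s≤s 2+i≤L) = no-return N i 2+i≤L

  nb-tail : ∀ {L f} → NonBacktracking (suc L) f → NonBacktracking L (f ∘ suc)
  adjacent  (nb-tail N) i i<L   = adjacent N (suc i) (s≤s i<L)
  no-return (nb-tail N) i 2+i≤L = no-return N (suc i) (s≤s 2+i≤L)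

  nb⇒walk : ∀ L {f} → NonBacktracking L f → Walk G (f 0) (f L) L
  nb⇒walk zero    N = nil
  nb⇒walk (suc L) N = cons (adjacent N 0 (s≤s z≤n)) (nb⇒walk L (nb-tail N))

  nb-glue : ∀ l₁ {l₂ f₁ f₂} → NonBacktracking l₁ f₁ → NonBacktracking l₂ f₂ → f₁ 0 ≡ f₂ 0 →
            (1 ≤ l₁ → 1 ≤ l₂ → f₁ 1 ≢ f₂ 1) →
            ∃[ h ] NonBacktracking (l₁ + l₂) h × h 0 ≡ f₁ l₁ × h (l₁ + l₂) ≡ f₂ l₂
  nb-glue zero {f₂ = f₂} _ N₂ f₁0≡f₂0 _ = f₂ , N₂ , sym f₁0≡f₂0 , refl
  nb-glue (suc l₁) {l₂} {f₁} {f₂} N₁ N₂ f₁0≡f₂0 diverge =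
    shift (nb-glue l₁ (nb-tail N₁) N₂′ refl (λ 1≤l₁ _ → no-return N₁ 0 (s≤s 1≤l₁) ∘ trans f₁0≡f₂0 ∘ sym))
    where
    N₂′ : NonBacktracking (suc l₂) (f₁ 1 ◂ f₂)
    N₂′ = nb-∷ (subst (Adj G (f₁ 1)) f₁0≡f₂0 (adj-sym (adjacent N₁ 0 (s≤s z≤n)))) (diverge (s≤s z≤n)) N₂
    shift : ∃[ h ] NonBacktracking (l₁ + suc l₂) h × h 0 ≡ f₁ (suc l₁) × h (l₁ + suc l₂) ≡ f₂ l₂ →
            ∃[ h ] NonBacktracking (suc l₁ + l₂) h × h 0 ≡ f₁ (suc l₁) × h (suc l₁ + l₂) ≡ f₂ l₂
    shift (h , N , h0 , hL) = h , subst (λ l → NonBacktracking l h) (+-suc l₁ l₂) N , h0 , trans (cong h (sym (+-suc l₁ l₂))) hL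

  module _ {L f} (N : NonBacktracking L f) where

    Repeat : ℕ → Set
    Repeat b = ∃[ a ] a < b × f a ≡ f b

    repeat? : ∀ b → Dec (Repeat b)
    repeat? b = exists-below? (λ a → f a Finₚ.≟ f b) b

    repeat-gap≥3 : ∀ {a} m → a + m ≤ L → 1 ≤ m → f a ≡ f (a + m) → 3 ≤ m
    repeat-gap≥3 {a} 1 a+1≤L _ fa≡ = contradiction
      (subst (Adj G (f a)) (trans (cong f (+-comm 1 a)) (sym fa≡)) (adjacent N a (subst (_≤ L) (+-comm a 1) a+1≤L)))
      adj-irrefl
    repeat-gap≥3 {a} 2 a+2≤L _ fa≡ =
      contradiction (trans fa≡ (cong f (+-comm a 2))) (no-return N a (subst (_≤ L) (+-comm a 2) a+2≤L))
    repeat-gap≥3 (suc (suc (suc _))) _ _ _ = s≤s (s≤s (s≤s z≤n))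

    segment-cycle : ∀ a m → a + m ≤ L → 1 ≤ m → f a ≡ f (a + m) →
                    (∀ c → c < a + m → ¬ Repeat c) → Cycle G m
    segment-cycle a m a+m≤L 1≤m fa≡ first = record
      { len≥3 = repeat-gap≥3 m a+m≤L 1≤m fa≡
      ; vtx   = vtx′
      ; inj   = inj′
      ; step  = λ i j 1+i≡j → subst (Adj G (vtx′ i) ∘ f) (trans (sym (+-suc a (toℕ i))) (cong (a +_) 1+i≡j)) (edge i)
      ; close = λ i j 1+i≡m j≡0 → subst (Adj G (vtx′ i)) (closing 1+i≡m j≡0) (edge i)
      }
      where
      vtx′ : Fin m → V G
      vtx′ t = f (a + toℕ t)
      inside : ∀ t → a + toℕ t < a + m
      inside t = +-monoʳ-< a (Finₚ.toℕ<n t)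
      edge : ∀ i → Adj G (vtx′ i) (f (suc (a + toℕ i)))
      edge i = adjacent N (a + toℕ i) (<-≤-trans (inside i) a+m≤L)
      closing : ∀ {i j : Fin m} → suc (toℕ i) ≡ m → toℕ j ≡ 0 → f (suc (a + toℕ i)) ≡ vtx′ j
      closing {i} {j} 1+i≡m j≡0 = begin
        f (suc (a + toℕ i)) ≡⟨ cong f (trans (sym (+-suc a (toℕ i))) (cong (a +_) 1+i≡m)) ⟩
        f (a + m)           ≡⟨ fa≡ ⟨
        f a                 ≡⟨ cong f (trans (sym (+-identityʳ a)) (cong (a +_) (sym j≡0))) ⟩
        vtx′ j              ∎
        where open ≡-Reasoning
      no-earlier : ∀ s t → toℕ s < toℕ t → vtx′ s ≢ vtx′ t
      no-earlier s t s<t e = first (a + toℕ t) (inside t) (a + toℕ s , +-monoʳ-< a s<t , e)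
      inj′ : ∀ {s t} → vtx′ s ≡ vtx′ t → s ≡ t
      inj′ {s} {t} e with <-cmp (toℕ s) (toℕ t)
      ... | tri< s<t _ _ = contradiction e (no-earlier s t s<t)
      ... | tri≈ _ s≡t _ = Finₚ.toℕ-injective s≡t
      ... | tri> _ _ t<s = contradiction (sym e) (no-earlier t s t<s)

    -- The first repetition f a ≡ f b along the walk closes the cycle f a, …, f (b - 1).
    closed-nb⇒cycle : 1 ≤ L → f 0 ≡ f L → ∃[ m ] m ≤ L × Cycle G m
    closed-nb⇒cycle 1≤L f0≡fL with least repeat? (0 , 1≤L , f0≡fL)
    ... | b , b≤L , (a , a<b , fa≡fb) , first with b ∸ a | m+[n∸m]≡n (<⇒≤ a<b)
    ...   | m | refl = m , ≤-trans (m≤n+m m a) b≤L ,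
                       segment-cycle a m b≤L (+-cancelˡ-< a 0 m (subst (_< a + m) (sym (+-identityʳ a)) a<b)) fa≡fb first

  girth≤closed-nb : ∀ {g L f} → (∀ m → Cycle G m → g ≤ m) → NonBacktracking L f → 1 ≤ L → f 0 ≡ f L → g ≤ L
  girth≤closed-nb girth-min N 1≤L closed with m , m≤L , C ← closed-nb⇒cycle N 1≤L closed = ≤-trans (girth-min m C) m≤L

-- Positions on a cycle

module Cyclic (q : ℕ) .{{_ : NonZero q}} where

  infix 4 _≈_
  _≈_ : ℕ → ℕ → Set
  a ≈ b = a % q ≡ b % q

  ≈-+ʳ : ∀ {a b} c → a ≈ b → a + c ≈ b + c
  ≈-+ʳ {a} {b} c a≈b = begin
    (a + c) % q             ≡⟨ %-distribˡ-+ a c q ⟩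
    (a % q + c % q) % q     ≡⟨ cong (λ x → (x + c % q) % q) a≈b ⟩
    (b % q + c % q) % q     ≡⟨ %-distribˡ-+ b c q ⟨
    (b + c) % q             ∎
    where open ≡-Reasoning

  ≈-+ˡ : ∀ {a b} c → a ≈ b → c + a ≈ c + b
  ≈-+ˡ {a} {b} c a≈b = subst₂ _≈_ (+-comm a c) (+-comm b c) (≈-+ʳ c a≈b)

  +q≈ : ∀ a → a + q ≈ a
  +q≈ a = [m+n]%n≡m%n a q

  %≈ : ∀ a → a % q ≈ a
  %≈ a = m%n%n≡m%n a q

  ≡⇒≈ : ∀ {a b} → a ≡ b → a ≈ b
  ≡⇒≈ = cong (_% q)

  ≈⇒≡ : ∀ {a b} → a < q → b < q → a ≈ b → a ≡ b
  ≈⇒≡ a<q b<q a≈b = trans (sym (m<n⇒m%n≡m a<q)) (trans a≈b (m<n⇒m%n≡m b<q))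

  complement : ℕ → ℕ
  complement a = q ∸ a % q

  +complement≈0 : ∀ a → a + complement a ≈ 0
  +complement≈0 a = begin
    (a + (q ∸ a % q)) % q       ≡⟨ ≈-+ʳ (q ∸ a % q) (%≈ a) ⟨
    (a % q + (q ∸ a % q)) % q   ≡⟨ cong (_% q) (m+[n∸m]≡n (<⇒≤ (m%n<n a q))) ⟩
    q % q                       ≡⟨ +q≈ 0 ⟩
    0 % q                       ∎
    where open ≡-Reasoning

  +-cancelˡ-≈ : ∀ c {a b} → c + a ≈ c + b → a ≈ b
  +-cancelˡ-≈ c {a} {b} c+a≈c+b = begin
    a % q                          ≡⟨ ≈-+ʳ a (+complement≈0 c) ⟨
    (c + complement c + a) % q     ≡⟨ ≡⇒≈ (reorder a) ⟩
    (complement c + (c + a)) % q   ≡⟨ ≈-+ˡ (complement c) c+a≈c+b ⟩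
    (complement c + (c + b)) % q   ≡⟨ ≡⇒≈ (reorder b) ⟨
    (c + complement c + b) % q     ≡⟨ ≈-+ʳ b (+complement≈0 c) ⟩
    b % q                          ∎
    where
    open ≡-Reasoning
    reorder : ∀ x → c + complement c + x ≡ complement c + (c + x)
    reorder x = trans (cong (_+ x) (+-comm c (complement c))) (+-assoc (complement c) c x)

  -- The offset from a to b: the unique t < q with a + t ≈ b.
  off : ℕ → ℕ → ℕ
  off a b = (b + complement a) % q

  off<q : ∀ a b → off a b < q
  off<q a b = m%n<n _ q

  +off≈ : ∀ a b → a + off a b ≈ b
  +off≈ a b = begin
    (a + off a b) % q              ≡⟨ ≈-+ˡ a (%≈ (b + complement a)) ⟩
    (a + (b + complement a)) % q   ≡⟨ ≡⇒≈ (x∙yz≈y∙xz a b (complement a)) ⟩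
    (b + (a + complement a)) % q   ≡⟨ ≈-+ˡ b (+complement≈0 a) ⟩
    (b + 0) % q                    ≡⟨ ≡⇒≈ (+-identityʳ b) ⟩
    b % q                          ∎
    where open ≡-Reasoning

  off≡⇒≈ : ∀ a b {t} → off a b ≡ t → a + t ≈ b
  off≡⇒≈ a b t≡ = subst (λ t → a + t ≈ b) t≡ (+off≈ a b)

  off-unique : ∀ a {b t} → t < q → a + t ≈ b → off a b ≡ t
  off-unique a {b} t<q a+t≈b = ≈⇒≡ (off<q a b) t<q (+-cancelˡ-≈ a (trans (+off≈ a b) (sym a+t≈b)))

  off-resp : ∀ {a a′ b b′} → a ≈ a′ → b ≈ b′ → off a b ≡ off a′ b′
  off-resp {a} {a′} {b} {b′} a≈a′ b≈b′ = sym (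
    off-unique a′ (off<q a b) (trans (≈-+ʳ (off a b) (sym a≈a′)) (trans (+off≈ a b) b≈b′)))

  off-shift : ∀ a b r → off (a + r) (b + r) ≡ off a b
  off-shift a b r = off-unique (a + r) (off<q a b)
    (trans (≡⇒≈ (xy∙z≈xz∙y a r (off a b))) (≈-+ʳ r (+off≈ a b)))

  off-flip : ∀ a b → off a b ≢ 0 → off b a ≡ q ∸ off a b
  off-flip a b t≢0 = off-unique b (∸-monoʳ-< (n≢0⇒n>0 t≢0) (<⇒≤ (off<q a b))) (begin
    (b + (q ∸ t)) % q       ≡⟨ ≈-+ʳ (q ∸ t) (+off≈ a b) ⟨
    (a + t + (q ∸ t)) % q   ≡⟨ ≡⇒≈ (trans (+-assoc a t (q ∸ t)) (cong (a +_) (m+[n∸m]≡n (<⇒≤ (off<q a b))))) ⟩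
    (a + q) % q             ≡⟨ +q≈ a ⟩
    a % q                   ∎)
    where
    open ≡-Reasoning
    t = off a b

  cd : ℕ → ℕ → ℕ
  cd a b = off a b ⊓ off b a

  cd-sym : ∀ a b → cd a b ≡ cd b a
  cd-sym a b = ⊓-comm (off a b) (off b a)

  cd-resp : ∀ {a a′ b b′} → a ≈ a′ → b ≈ b′ → cd a b ≡ cd a′ b′
  cd-resp a≈a′ b≈b′ = cong₂ _⊓_ (off-resp a≈a′ b≈b′) (off-resp b≈b′ a≈a′)

  cd-shift : ∀ a b r → cd (a + r) (b + r) ≡ cd a b
  cd-shift a b r = cong₂ _⊓_ (off-shift a b r) (off-shift b a r)

  cd-shiftˡ : ∀ r a b → cd (r + a) (r + b) ≡ cd a b
  cd-shiftˡ r a b = trans (cong₂ cd (+-comm r a) (+-comm r b)) (cd-shift a b r)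

  cd-off : ∀ β a b → cd a b ≡ cd (off β a) (off β b)
  cd-off β a b = trans (cd-resp (sym (+off≈ β a)) (sym (+off≈ β b))) (cd-shiftˡ β (off β a) (off β b))

  off≡0⇒≈ : ∀ a b → off a b ≡ 0 → a ≈ b
  off≡0⇒≈ a b t≡0 = trans (≡⇒≈ (sym (+-identityʳ a))) (off≡⇒≈ a b t≡0)

  cd≡0⇒≈ : ∀ a b → cd a b ≡ 0 → a ≈ b
  cd≡0⇒≈ a b cd≡0 with ⊓-sel (off a b) (off b a)
  ... | inj₁ cd≡t = off≡0⇒≈ a b (trans (sym cd≡t) cd≡0)
  ... | inj₂ cd≡u = sym (off≡0⇒≈ b a (trans (sym cd≡u) cd≡0))

  cd-+ : ∀ a {t} → t < q → cd a (a + t) ≡ t ⊓ (q ∸ t)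
  cd-+ a {zero}  _   = cong (_⊓ off (a + 0) a) (off-unique a (>-nonZero⁻¹ q) refl)
  cd-+ a {suc t} t<q = cong₂ _⊓_ t-off (trans (off-flip a (a + suc t) (1+n≢0 ∘ trans (sym t-off))) (cong (q ∸_) t-off))
    where
    t-off : off a (a + suc t) ≡ suc t
    t-off = off-unique a t<q refl

  cd-+-short : ∀ a {t} → t + t < q → cd a (a + t) ≡ t
  cd-+-short a {t} 2t<q = trans (cd-+ a (≤-<-trans (m≤m+n t t) 2t<q))
    (m≤n⇒m⊓n≡m (subst (_≤ q ∸ t) (m+n∸n≡m t t) (∸-monoˡ-≤ t (<⇒≤ 2t<q))))

  cd-< : ∀ {x y} → x < q → y < q → cd x y ≡ ∣ x - y ∣ ⊓ (q ∸ ∣ x - y ∣)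
  cd-< {x} {y} x<q y<q with ≤-total x y
  ... | inj₁ x≤y = begin
    cd x y                     ≡⟨ cong (cd x) (m+[n∸m]≡n x≤y) ⟨
    cd x (x + (y ∸ x))         ≡⟨ cd-+ x (≤-<-trans (m∸n≤m y x) y<q) ⟩
    (y ∸ x) ⊓ (q ∸ (y ∸ x))    ≡⟨ cong (λ d → d ⊓ (q ∸ d)) (m≤n⇒∣m-n∣≡n∸m x≤y) ⟨
    ∣ x - y ∣ ⊓ (q ∸ ∣ x - y ∣) ∎
    where open ≡-Reasoning
  ... | inj₂ y≤x = begin
    cd x y                     ≡⟨ cd-sym x y ⟩
    cd y x                     ≡⟨ cong (cd y) (m+[n∸m]≡n y≤x) ⟨
    cd y (y + (x ∸ y))         ≡⟨ cd-+ y (≤-<-trans (m∸n≤m x y) x<q) ⟩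
    (x ∸ y) ⊓ (q ∸ (x ∸ y))    ≡⟨ cong (λ d → d ⊓ (q ∸ d)) (m≤n⇒∣n-m∣≡n∸m y≤x) ⟨
    ∣ x - y ∣ ⊓ (q ∸ ∣ x - y ∣) ∎
    where open ≡-Reasoning

%-injective-close : ∀ n {x y} → ∣ x - y ∣ ≤ n → x % suc n ≡ y % suc n → x ≡ y
%-injective-close n {x} {y} close x≈y = [ (λ x≤y → ordered x≤y (subst (_≤ n) (m≤n⇒∣m-n∣≡n∸m x≤y) close) x≈y)
                                        , (λ y≤x → sym (ordered y≤x (subst (_≤ n) (m≤n⇒∣n-m∣≡n∸m y≤x) close) (sym x≈y)))
                                        ]′ (≤-total x y)
  where
  open Cyclic (suc n)
  ordered : ∀ {a b} → a ≤ b → b ∸ a ≤ n → a ≈ b → a ≡ b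
  ordered {a} {b} a≤b gap a≈b = trans (sym (+-identityʳ a)) (trans (cong (a +_) gap≡0) (m+[n∸m]≡n a≤b))
    where
    gap≡0 : 0 ≡ b ∸ a
    gap≡0 = ≈⇒≡ (s≤s z≤n) (s≤s gap)
      (+-cancelˡ-≈ a (trans (≡⇒≈ (+-identityʳ a)) (trans a≈b (≡⇒≈ (sym (m+[n∸m]≡n a≤b))))))

module OnCycle {G : Graph} {m : ℕ} (C : Cycle G m) where
  open Walks G

  instance
    length-nonZero : NonZero m
    length-nonZero = >-nonZero (≤-trans (s≤s z≤n) (len≥3 C))

  open Cyclic m public

  pos : ℕ → V G
  pos a = vtx C (a mod m)

  toℕ-mod : ∀ a → toℕ (a mod m) ≡ a % m
  toℕ-mod a = Finₚ.toℕ-fromℕ< (m%n<n a m)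

  pos-resp : ∀ {a b} → a ≈ b → pos a ≡ pos b
  pos-resp {a} {b} a≈b = cong (vtx C) (Finₚ.toℕ-injective (trans (toℕ-mod a) (trans a≈b (sym (toℕ-mod b)))))

  pos-toℕ : ∀ i → pos (toℕ i) ≡ vtx C i
  pos-toℕ i = cong (vtx C) (Finₚ.toℕ-injective (trans (toℕ-mod (toℕ i)) (m<n⇒m%n≡m (Finₚ.toℕ<n i))))

  pos-adj : ∀ a → Adj G (pos a) (pos (suc a))
  pos-adj a with suc (a % m) <? m
  ... | yes 1+a%m<m = step C (a mod m) (suc a mod m) (trans (cong suc (toℕ-mod a)) (sym (begin
    toℕ (suc a mod m)   ≡⟨ toℕ-mod (suc a) ⟩
    suc a % m           ≡⟨ ≈-+ˡ 1 (%≈ a) ⟨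
    suc (a % m) % m     ≡⟨ m<n⇒m%n≡m 1+a%m<m ⟩
    suc (a % m)         ∎)))
    where open ≡-Reasoning
  ... | no  1+a%m≮m = close C (a mod m) (suc a mod m) (trans (cong suc (toℕ-mod a)) 1+a%m≡m) (begin
    toℕ (suc a mod m)   ≡⟨ toℕ-mod (suc a) ⟩
    suc a % m           ≡⟨ ≈-+ˡ 1 (%≈ a) ⟨
    suc (a % m) % m     ≡⟨ cong (_% m) 1+a%m≡m ⟩
    m % m               ≡⟨ n%n≡0 m ⟩
    0                   ∎)
    where
    open ≡-Reasoning
    1+a%m≡m : suc (a % m) ≡ m
    1+a%m≡m = ≤-antisym (m%n<n a m) (≮⇒≥ 1+a%m≮m)

  forward : ∀ a t → Walk G (pos a) (pos (a + t)) t
  forward a zero    = subst (λ b → Walk G (pos a) (pos b) 0) (sym (+-identityʳ a)) nil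
  forward a (suc t) = cons (pos-adj a) (subst (λ b → Walk G (pos (suc a)) (pos b) t) (sym (+-suc a t)) (forward (suc a) t))

  forward-to : ∀ a b → Walk G (pos a) (pos b) (off a b)
  forward-to a b = subst (λ c → Walk G (pos a) c (off a b)) (pos-resp (+off≈ a b)) (forward a (off a b))

  around : ∀ a b → Walk G (pos a) (pos b) (cd a b)
  around a b with ⊓-sel (off a b) (off b a)
  ... | inj₁ cd≡t = subst (Walk G (pos a) (pos b)) (sym cd≡t) (forward-to a b)
  ... | inj₂ cd≡u = subst (Walk G (pos a) (pos b)) (sym cd≡u) (reverseʷ (forward-to b a))

  cd-toℕ : ∀ (i j : Fin m) → cd (toℕ i) (toℕ j) ≡ cycDist m i j
  cd-toℕ i j = cd-< (Finₚ.toℕ<n i) (Finₚ.toℕ<n j)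

  around-toℕ : ∀ i j → Walk G (vtx C i) (vtx C j) (cycDist m i j)
  around-toℕ i j = subst₃ (pos-toℕ i) (pos-toℕ j) (cd-toℕ i j) (around (toℕ i) (toℕ j))
    where
    subst₃ : ∀ {x x′ y y′ l l′} → x ≡ x′ → y ≡ y′ → l ≡ l′ → Walk G x y l → Walk G x′ y′ l′
    subst₃ refl refl refl w = w

module Rigidity (q : ℕ) .{{_ : NonZero q}} where
  open Cyclic q

  module _ {e K : ℕ} (room : 2 * e + 3 * K < q) where

    -- An offset t with e < t ≤ e + K becomes t + K with e + K < t + K < q ∸ (e + K).
    rigid-half : ∀ {c c′} → off c c′ ≤ e + K → cd c (c′ + K) ≤ e + K → off c c′ ≤ e
    rigid-half {c} {c′} t≤e+K cd≤ with off c c′ ≤? e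
    ... | yes t≤e = t≤e
    ... | no  t≰e = [ (λ t+K≤e+K → contradiction (+-cancelʳ-≤ K _ _ t+K≤e+K) t≰e)
                    , (λ q≤ → contradiction (≤-trans q≤ (far t≤e+K)) (<⇒≱ room))
                    ]′ (short-arc (subst (_≤ e + K) (cd-further t≤e+K) cd≤))
      where
      far : off c c′ ≤ e + K → off c c′ + K + (e + K) ≤ 2 * e + 3 * K
      far t≤ = ≤-trans (+-monoˡ-≤ (e + K) (+-monoˡ-≤ K t≤)) (≤-reflexive (identity e K))
        where
        identity : ∀ e K → e + K + K + (e + K) ≡ 2 * e + 3 * K
        identity = solve-∀
      cd-further : off c c′ ≤ e + K → cd c (c′ + K) ≡ (off c c′ + K) ⊓ (q ∸ (off c c′ + K))
      cd-further t≤ = trans (cd-resp refl (trans (≈-+ʳ K (sym (+off≈ c c′))) (≡⇒≈ (+-assoc c (off c c′) K))))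
                            (cd-+ c (≤-<-trans (≤-trans (m≤m+n _ (e + K)) (far t≤)) room))

    rigid : ∀ {c c′} → cd c c′ ≤ e + K → cd c (c′ + K) ≤ e + K → cd (c + K) c′ ≤ e + K → cd c c′ ≤ e
    rigid {c} {c′} h₀ h₁ h₂ with ⊓-sel (off c c′) (off c′ c)
    ... | inj₁ cd≡t = subst (_≤ e) (sym cd≡t) (rigid-half (subst (_≤ e + K) cd≡t h₀) h₁)
    ... | inj₂ cd≡u = subst (_≤ e) (sym cd≡u) (rigid-half (subst (_≤ e + K) cd≡u h₀) (subst (_≤ e + K) (cd-sym (c + K) c′) h₂))

  module _ {K : ℕ} (room : K + K < q) where

    locate-forward : ∀ {b c s} → s ≤ K → off b c ≤ s → cd c (b + K) ≤ K ∸ s → c ≈ b + s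
    locate-forward {b} {c} {s} s≤K t≤s cd≤ =
      [ (λ K∸t≤K∸s → trans (sym (+off≈ b c)) (cong (λ x → (b + x) % q) (≤-antisym t≤s (∸-cancelʳ-≤ s≤K K∸t≤K∸s))))
      , (λ q≤ → contradiction (≤-trans q≤ (+-mono-≤ (m∸n≤m K t) (m∸n≤m K s))) (<⇒≱ room))
      ]′ (short-arc (subst (_≤ K ∸ s) cd≡ cd≤))
      where
      t = off b c
      t≤K = ≤-trans t≤s s≤K
      cd≡ : cd c (b + K) ≡ (K ∸ t) ⊓ (q ∸ (K ∸ t))
      cd≡ = trans (cd-resp refl (begin
          (b + K) % q               ≡⟨ ≡⇒≈ (cong (b +_) (m+[n∸m]≡n t≤K)) ⟨
          (b + (t + (K ∸ t))) % q   ≡⟨ ≡⇒≈ (+-assoc b t (K ∸ t)) ⟨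
          (b + t + (K ∸ t)) % q     ≡⟨ ≈-+ʳ (K ∸ t) (+off≈ b c) ⟩
          (c + (K ∸ t)) % q         ∎))
        (cd-+ c (≤-<-trans (m∸n≤m K t) (≤-<-trans (m≤m+n K K) room)))
        where open ≡-Reasoning

    locate : ∀ {b c s} → s ≤ K → cd b c ≤ s → cd c (b + K) ≤ K ∸ s → c ≈ b + s
    locate {b} {c} {s} s≤K cd≤s cd≤ with ⊓-sel (off b c) (off c b)
    ... | inj₁ cd≡t = locate-forward s≤K (subst (_≤ s) cd≡t cd≤s) cd≤
    ... | inj₂ cd≡u = [ (λ u+K≤K∸s → locate-forward s≤K (subst (_≤ s) (sym (t≡0 (u≡0 u+K≤K∸s))) z≤n) cd≤)
                      , (λ q≤ → contradiction (≤-trans q≤ (u+K+K∸s≤K+K)) (<⇒≱ room))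
                      ]′ (short-arc (subst (_≤ K ∸ s) cd≡ cd≤))
      where
      u = off c b
      u≤s : u ≤ s
      u≤s = subst (_≤ s) cd≡u cd≤s
      u+K+K∸s≤K+K : u + K + (K ∸ s) ≤ K + K
      u+K+K∸s≤K+K = begin
        u + K + (K ∸ s)   ≡⟨ xy∙z≈y∙xz u K (K ∸ s) ⟩
        K + (u + (K ∸ s)) ≤⟨ +-monoʳ-≤ K (+-monoˡ-≤ (K ∸ s) u≤s) ⟩
        K + (s + (K ∸ s)) ≡⟨ cong (K +_) (m+[n∸m]≡n s≤K) ⟩
        K + K             ∎
        where open ≤-Reasoning
      cd≡ : cd c (b + K) ≡ (u + K) ⊓ (q ∸ (u + K))
      cd≡ = trans (cd-resp refl (trans (≈-+ʳ K (sym (+off≈ c b))) (≡⇒≈ (+-assoc c u K))))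
                  (cd-+ c (≤-<-trans (+-monoˡ-≤ K (≤-trans u≤s s≤K)) room))
      u≡0 : u + K ≤ K ∸ s → u ≡ 0
      u≡0 u+K≤ = n≤0⇒n≡0 (+-cancelʳ-≤ K u 0 (≤-trans u+K≤ (m∸n≤m K s)))
      t≡0 : u ≡ 0 → off b c ≡ 0
      t≡0 u≡0 = off-unique b (>-nonZero⁻¹ q) (trans (≡⇒≈ (+-identityʳ b)) (sym (off≡0⇒≈ c b u≡0)))

module Arcs (q : ℕ) .{{_ : NonZero q}} where
  open Cyclic q

  module Window {P : Fin q → Bool} {E} (3E<q : 3 * E < q)
                (close : ∀ i j → T (P i) → T (P j) → cd (toℕ i) (toℕ j) ≤ E) {s} (Ps : T (P s)) where

    E<q : E < q
    E<q = ≤-<-trans (m≤m+n E _) 3E<q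

    -- τ i is the offset of i from s - E.
    β : ℕ
    β = toℕ s + (q ∸ E)

    τ : Fin q → ℕ
    τ i = off β (toℕ i)

    τ-s : τ s ≡ E
    τ-s = off-unique β E<q (trans (≡⇒≈ (trans (+-assoc (toℕ s) (q ∸ E) E) (cong (toℕ s +_) (m∸n+n≡m (<⇒≤ E<q)))))
                                  (+q≈ (toℕ s)))

    τ-arc : ∀ i j → T (P i) → T (P j) → ∣ τ i - τ j ∣ ⊓ (q ∸ ∣ τ i - τ j ∣) ≤ E
    τ-arc i j Pi Pj = subst (_≤ E) (trans (cd-off β _ _) (cd-< (off<q β _) (off<q β _))) (close i j Pi Pj)

    τ-bound : ∀ i → T (P i) → τ i ≤ E + E
    τ-bound i Pi with ≤-total E (τ i)
    ... | inj₂ τ≤E = ≤-trans τ≤E (m≤m+n E E)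
    ... | inj₁ E≤τ with short-arc (subst (λ d → d ⊓ (q ∸ d) ≤ E) (trans (cong (∣_- τ i ∣) τ-s) (m≤n⇒∣m-n∣≡n∸m E≤τ))
                                         (τ-arc s i Ps Pi))
    ...   | inj₁ τ∸E≤E = ∸≤⇒≤+ τ∸E≤E
    ...   | inj₂ q≤τ   = contradiction (subst (q ≤_) (m∸n+n≡m E≤τ) q≤τ) (<⇒≱ (off<q β (toℕ i)))

    τ-close : ∀ i j → T (P i) → T (P j) → ∣ τ i - τ j ∣ ≤ E
    τ-close i j Pi Pj with short-arc (τ-arc i j Pi Pj)
    ... | inj₁ close′ = close′
    ... | inj₂ q≤     = contradiction (≤-trans q≤ (+-monoˡ-≤ E gap≤2E)) (<⇒≱ (subst (_< q) 3E≡ 3E<q))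
      where
      gap≤2E : ∣ τ i - τ j ∣ ≤ E + E
      gap≤2E = ≤-trans (∣m-n∣≤m⊔n (τ i) (τ j)) (⊔-lub (τ-bound i Pi) (τ-bound j Pj))
      3E≡ : 3 * E ≡ E + E + E
      3E≡ = trans (cong (λ x → E + (E + x)) (+-identityʳ E)) (sym (+-assoc E E E))

    τ-injective : ∀ {i j} → τ i ≡ τ j → i ≡ j
    τ-injective {i} {j} τi≡τj = Finₚ.toℕ-injective (≈⇒≡ (Finₚ.toℕ<n i) (Finₚ.toℕ<n j)
      (trans (sym (+off≈ β (toℕ i))) (trans (cong (λ t → (β + t) % q) τi≡τj) (+off≈ β (toℕ j)))))

    ψ : Fin q → Fin (suc E)
    ψ i = τ i mod suc E

    ψ-injective : ∀ {i j} → T (P i) → T (P j) → ψ i ≡ ψ j → i ≡ j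
    ψ-injective {i} {j} Pi Pj ψi≡ψj =
      τ-injective (%-injective-close E (τ-close i j Pi Pj) (trans (sym (toℕ-ψ i)) (trans (cong toℕ ψi≡ψj) (toℕ-ψ j))))
      where
      toℕ-ψ : ∀ i → toℕ (ψ i) ≡ τ i % suc E
      toℕ-ψ i = Finₚ.toℕ-fromℕ< (m%n<n (τ i) (suc E))

  arc-count : ∀ (P : Fin q → Bool) E → 3 * E < q →
              (∀ i j → T (P i) → T (P j) → cd (toℕ i) (toℕ j) ≤ E) → count P ≤ suc E
  arc-count P E 3E<q close with Finₚ.any? (λ i → T? (P i))
  ... | no ∄P = subst (_≤ suc E) (sym (count-none P (λ i Pi → ∄P (i , Pi)))) z≤n
  ... | yes (s , Ps) = begin
    count P                     ≡⟨ length-elems P ⟨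
    length (elems P)            ≡⟨ length-map ψ (elems P) ⟨
    length (map ψ (elems P))    ≤⟨ length≤count (λ _ → true) ψ-elems-unique (All.universal _ _) ⟩
    count {suc E} (λ _ → true)  ≡⟨ trans (∑-const (suc E) 1) (*-identityʳ (suc E)) ⟩
    suc E                       ∎
    where
    open ≤-Reasoning
    open Window 3E<q close Ps
    ψ-elems-unique : Unique (map ψ (elems P))
    ψ-elems-unique = Unique-map-on ψ ψ-injective (All.tabulate (∈-elems⁻ P)) (elems-unique P)

-- The Moore bound

Moore-odd : ∀ {δ g} → odd g ≡ true → Moore δ g ≡ 1 + sumFrom 0 (kOf g) (λ i → δ * (δ ∸ 1) ^ i)
Moore-odd odd-g rewrite odd-g = refl

Moore-even : ∀ {δ g} → odd g ≡ false → Moore δ g ≡ 2 + sumFrom 1 (kOf g) (λ i → 2 * (δ ∸ 1) ^ i)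
Moore-even even-g rewrite even-g = refl

data Parity (g k : ℕ) : Set where
  odd-girth  : odd g ≡ true  → g ≡ 1 + 2 * k → Parity g k
  even-girth : odd g ≡ false → g ≡ 2 + 2 * k → Parity g k

parity : ∀ g → 1 ≤ g → Parity g (kOf g)
parity 1                   _ = odd-girth refl refl
parity 2                   _ = even-girth refl refl
parity (suc (suc (suc h))) _ = advance (m/n≡1+[m∸n]/n {2 + h} {2} (s≤s (s≤s z≤n))) (parity (suc h) (s≤s z≤n))
  where
  two-more : ∀ {c} k → 2 + (c + 2 * k) ≡ c + 2 * suc k
  two-more {c} k = sym (trans (cong (c +_) (*-suc 2 k)) (x∙yz≈y∙xz c 2 (2 * k)))
  advance : ∀ {k k′} → k ≡ suc k′ → Parity (suc h) k′ → Parity (3 + h) k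
  advance {k′ = k′} refl (odd-girth  odd-g  g≡) = odd-girth  odd-g  (trans (cong (2 +_) g≡) (two-more {1} k′))
  advance {k′ = k′} refl (even-girth even-g g≡) = even-girth even-g (trans (cong (2 +_) g≡) (two-more {2} k′))

k≥1 : ∀ {g k} → Parity g k → 3 ≤ g → 1 ≤ k
k≥1 {k = suc _} _                     _             = s≤s z≤n
k≥1 {k = zero}  (odd-girth  _ refl) (s≤s ())
k≥1 {k = zero}  (even-girth _ refl) (s≤s (s≤s ()))

module Moore-bound (G : Graph) (δ g : ℕ) (min-deg : ∀ v → δ ≤ deg G v) (girth-min : ∀ m → Cycle G m → g ≤ m) where
  open Walks G
  open NonBacktracking

  theta-girth : ∀ {l₁ l₂ f₁ f₂} → NonBacktracking l₁ f₁ → NonBacktracking l₂ f₂ → f₁ 0 ≡ f₂ 0 → f₁ l₁ ≡ f₂ l₂ →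
                (1 ≤ l₁ → 1 ≤ l₂ → f₁ 1 ≢ f₂ 1) → 1 ≤ l₁ + l₂ → g ≤ l₁ + l₂
  theta-girth {l₁} N₁ N₂ start end diverge 1≤l
    with h , N , h0 , hl ← nb-glue l₁ N₁ N₂ start diverge = girth≤closed-nb girth-min N 1≤l (trans h0 (trans end (sym hl)))

  neighbours : V G → V G → List (V G)
  neighbours c p = elems (λ u → adj G c u ∧ not (u == p))

  ∈-neighbours⁻ : ∀ {c p u} → u ∈ neighbours c p → Adj G c u × u ≢ p
  ∈-neighbours⁻ {c} {p} {u} u∈ = let c~u , u≠p = Equivalence.to T-∧ (∈-elems⁻ _ u∈) in c~u , ¬==⇒≢ u≠p

  deg≡count : ∀ c → deg G c ≡ count (adj G c)
  deg≡count c = sum-map-tabulate (λ u → ⟦ adj G c u ⟧) id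

  δ∸1≤|neighbours| : ∀ c p → δ ∸ 1 ≤ length (neighbours c p)
  δ∸1≤|neighbours| c p = begin
    δ ∸ 1                                  ≤⟨ ∸-monoˡ-≤ 1 (min-deg c) ⟩
    deg G c ∸ 1                            ≡⟨ cong (_∸ 1) (trans (deg≡count c) (count-remove (adj G c) p)) ⟩
    ⟦ adj G c p ⟧ + length-rest ∸ 1        ≤⟨ ∸-monoˡ-≤ 1 (+-monoˡ-≤ length-rest (⟦⟧≤1 (adj G c p))) ⟩
    suc length-rest ∸ 1                    ≡⟨ length-elems (λ u → adj G c u ∧ not (u == p)) ⟨
    length (neighbours c p)                ∎
    where
    open ≤-Reasoning
    length-rest : ℕ
    length-rest = count (λ u → adj G c u ∧ not (u == p))
    ⟦⟧≤1 : ∀ b → ⟦ b ⟧ ≤ 1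
    ⟦⟧≤1 true  = ≤-refl
    ⟦⟧≤1 false = z≤n

  δ≤|neighbours-self| : ∀ c → δ ≤ length (neighbours c c)
  δ≤|neighbours-self| c = begin
    δ                                          ≤⟨ min-deg c ⟩
    deg G c                                    ≡⟨ trans (deg≡count c) (count-remove (adj G c) c) ⟩
    ⟦ adj G c c ⟧ + length-rest                ≡⟨ cong (λ b → ⟦ b ⟧ + length-rest) (Graph.irref G c) ⟩
    length-rest                                ≡⟨ length-elems (λ u → adj G c u ∧ not (u == c)) ⟨
    length (neighbours c c)                    ∎
    where
    open ≤-Reasoning
    length-rest : ℕ
    length-rest = count (λ u → adj G c u ∧ not (u == c))

  -- The ends of the non-backtracking walks of length ≤ d from c whose first step avoids p.
  tree : V G → V G → ℕ → List (V G)
  tree p c zero    = c ∷ []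
  tree p c (suc d) = c ∷ concatMap (λ u → tree c u d) (neighbours c p)

  record Branch (p c z : V G) (d : ℕ) : Set where
    field
      len       : ℕ
      path      : ℕ → V G
      len≤d     : len ≤ d
      start     : path 0 ≡ c
      end       : path len ≡ z
      nb        : NonBacktracking len path
      first-≢-p : 1 ≤ len → path 1 ≢ p
  open Branch

  branch-root : ∀ {p c d} → Branch p c c d
  branch-root {c = c} = record
    { len = 0 ; path = λ _ → c ; len≤d = z≤n ; start = refl ; end = refl ; nb = nb-[] ; first-≢-p = λ () }

  branch-∷ : ∀ {p c u z d} → Adj G c u → u ≢ p → Branch c u z d → Branch p c z (suc d)
  branch-∷ {c = c} c~u u≢p b = record
    { len       = suc (len b)
    ; path      = c ◂ path b
    ; len≤d     = s≤s (len≤d b)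
    ; start     = refl
    ; end       = end b
    ; nb        = nb-∷ (subst (Adj G c) (sym (start b)) c~u) (λ 1≤l → first-≢-p b 1≤l ∘ sym) (nb b)
    ; first-≢-p = λ _ → subst (_≢ _) (sym (start b)) u≢p
    }

  branch-∈ : ∀ {p c u z d} → u ∈ neighbours c p → Branch c u z d → Branch p c z (suc d)
  branch-∈ u∈ = let c~u , u≢p = ∈-neighbours⁻ u∈ in branch-∷ c~u u≢p

  tree-branch : ∀ d {p c z} → z ∈ tree p c d → Branch p c z d
  tree-branch zero    (here refl) = branch-root
  tree-branch (suc d) (here refl) = branch-root
  tree-branch (suc d) {p} {c} (there z∈)
    with u , u∈ , z∈tree ← find (∈-concatMap⁻ (λ u → tree c u d) {xs = neighbours c p} z∈) = branch-∈ u∈ (tree-branch d z∈tree)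

  tree-near : ∀ d {p c z} → z ∈ tree p c d → Near c z d
  tree-near d z∈ = let b = tree-branch d z∈ in
    len b , len≤d b , subst₂ (λ x y → Walk G x y (len b)) (start b) (end b) (nb⇒walk (len b) (nb b))

  branches-meet : ∀ {p₁ p₂ c z d₁ d₂} (b₁ : Branch p₁ c z d₁) (b₂ : Branch p₂ c z d₂) →
                  (1 ≤ len b₁ → 1 ≤ len b₂ → path b₁ 1 ≢ path b₂ 1) → 1 ≤ len b₁ + len b₂ → g ≤ d₁ + d₂
  branches-meet b₁ b₂ diverge 1≤l = ≤-trans
    (theta-girth (nb b₁) (nb b₂) (trans (start b₁) (sym (start b₂))) (trans (end b₁) (sym (end b₂))) diverge 1≤l)
    (+-mono-≤ (len≤d b₁) (len≤d b₂))

  tree-unique : ∀ d {p c} → 2 * d < g → Unique (tree p c d)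
  tree-unique zero          _     = [] ∷ []
  tree-unique (suc d) {p} {c} 2d<g =
    All.tabulate root-not-below ∷ Unique-concatMap (λ u → tree c u d) (elems-unique _) (λ _ → tree-unique d 2d′<g) disjoint
    where
    2d′<g : 2 * d < g
    2d′<g = ≤-<-trans (*-monoʳ-≤ 2 (n≤1+n d)) 2d<g
    subtree-branch : ∀ {z} → z ∈ concatMap (λ u → tree c u d) (neighbours c p) → Branch p c z (suc d)
    subtree-branch z∈ with u , u∈ , z∈tree ← find (∈-concatMap⁻ (λ u → tree c u d) {xs = neighbours c p} z∈) =
      branch-∈ u∈ (tree-branch d z∈tree)
    root-not-below : ∀ {z} → z ∈ concatMap (λ u → tree c u d) (neighbours c p) → c ≢ z
    root-not-below z∈ refl = <⇒≱ 2d<g (≤-trans (branches-meet {d₂ = 0} (subtree-branch z∈) (branch-root {p = c}) (λ _ ()) (s≤s z≤n))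
                                               (+-monoʳ-≤ (suc d) z≤n))
    disjoint : ∀ {u u′} → u ∈ neighbours c p → u′ ∈ neighbours c p → u ≢ u′ → Disjoint (tree c u d) (tree c u′ d)
    disjoint u∈ u′∈ u≢u′ (z∈ , z∈′) =
      <⇒≱ 2d<g (≤-trans (branches-meet (branch-∈ u∈ b) (branch-∈ u′∈ b′) diverge (s≤s z≤n))
                                (≤-reflexive (cong (suc d +_) (sym (+-identityʳ (suc d))))))
      where
      b = tree-branch d z∈
      b′ = tree-branch d z∈′
      diverge : _ → _ → path b 0 ≢ path b′ 0
      diverge _ _ e = u≢u′ (trans (sym (start b)) (trans e (start b′)))

  tree-length : ∀ d p c → sumFrom 0 (suc d) ((δ ∸ 1) ^_) ≤ length (tree p c d)
  tree-length zero    p c = s≤s z≤n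
  tree-length (suc d) p c = s≤s (begin
    sumFrom 1 (suc d) ((δ ∸ 1) ^_)                            ≡⟨ sumFrom-^-suc (δ ∸ 1) 0 (suc d) ⟩
    (δ ∸ 1) * sumFrom 0 (suc d) ((δ ∸ 1) ^_)                  ≤⟨ *-monoˡ-≤ _ (δ∸1≤|neighbours| c p) ⟩
    length (neighbours c p) * sumFrom 0 (suc d) ((δ ∸ 1) ^_)  ≤⟨ length-concatMap-≥ (λ u → tree c u d) _ (tree-length d c) (neighbours c p) ⟩
    length (concatMap (λ u → tree c u d) (neighbours c p))    ∎)
    where open ≤-Reasoning

  odd-ball-length : ∀ k x → 1 + sumFrom 0 k (λ i → δ * (δ ∸ 1) ^ i) ≤ length (tree x x k)
  odd-ball-length zero    x = s≤s z≤n
  odd-ball-length (suc k) x = s≤s (begin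
    sumFrom 0 (suc k) (λ i → δ * (δ ∸ 1) ^ i)              ≡⟨ sumFrom-*ˡ δ 0 (suc k) ((δ ∸ 1) ^_) ⟩
    δ * sumFrom 0 (suc k) ((δ ∸ 1) ^_)                     ≤⟨ *-monoˡ-≤ _ (δ≤|neighbours-self| x) ⟩
    length (neighbours x x) * sumFrom 0 (suc k) ((δ ∸ 1) ^_) ≤⟨ length-concatMap-≥ (λ u → tree x u k) _ (tree-length k x) (neighbours x x) ⟩
    length (concatMap (λ u → tree x u k) (neighbours x x))   ∎)
    where open ≤-Reasoning

  even-ball-length : ∀ k x y → 2 + sumFrom 1 k (λ i → 2 * (δ ∸ 1) ^ i) ≤ length (tree y x k ++ tree x y k)
  even-ball-length k x y = begin
    2 + sumFrom 1 k (λ i → 2 * (δ ∸ 1) ^ i)   ≡⟨ cong (2 +_) (sumFrom-*ˡ 2 1 k ((δ ∸ 1) ^_)) ⟩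
    2 + 2 * S                                 ≡⟨ double S ⟩
    sumFrom 0 (suc k) ((δ ∸ 1) ^_) + sumFrom 0 (suc k) ((δ ∸ 1) ^_)
                                              ≤⟨ +-mono-≤ (tree-length k y x) (tree-length k x y) ⟩
    length (tree y x k) + length (tree x y k) ≡⟨ length-++ (tree y x k) ⟨
    length (tree y x k ++ tree x y k)         ∎
    where
    open ≤-Reasoning
    S : ℕ
    S = sumFrom 1 k ((δ ∸ 1) ^_)
    double : ∀ s → 2 + 2 * s ≡ suc s + suc s
    double s = cong suc (trans (cong (suc s +_) (+-identityʳ s)) (sym (+-suc s s)))

  even-ball-unique : ∀ k {x y} → Adj G x y → 2 * k + 1 < g → Unique (tree y x k ++ tree x y k)
  even-ball-unique k {x} {y} x~y 2k+1<g = Unique-++⁺ (tree-unique k 2k<g) (tree-unique k 2k<g) disjoint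
    where
    2k<g : 2 * k < g
    2k<g = ≤-<-trans (m≤m+n (2 * k) 1) 2k+1<g
    disjoint : Disjoint (tree y x k) (tree x y k)
    disjoint (z∈ , z∈′) = <⇒≱ 2k+1<g (≤-trans (branches-meet b (branch-∷ x~y (λ y≡x → adj-irrefl (subst (Adj G x) y≡x x~y)) b′)
                                                 diverge (≤-trans (s≤s z≤n) (m≤n+m _ (len b))))
                                        (≤-reflexive (length-identity k)))
      where
      b = tree-branch k z∈
      b′ = tree-branch k z∈′
      diverge : 1 ≤ len b → _ → path b 1 ≢ path b′ 0
      diverge 1≤l _ e = first-≢-p b 1≤l (trans e (start b′))
      length-identity : ∀ k → k + suc k ≡ 2 * k + 1
      length-identity = solve-∀

  moore-odd : odd g ≡ true → 2 * kOf g < g → ∀ x (P : V G → Bool) → (∀ {z} → Near x z (kOf g) → T (P z)) →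
              Moore δ g ≤ count P
  moore-odd odd-g 2k<g x P near⇒P = begin
    Moore δ g                                          ≡⟨ Moore-odd {δ} {g} odd-g ⟩
    1 + sumFrom 0 (kOf g) (λ i → δ * (δ ∸ 1) ^ i)      ≤⟨ odd-ball-length (kOf g) x ⟩
    length (tree x x (kOf g))                          ≤⟨ length≤count P (tree-unique (kOf g) 2k<g) in-ball ⟩
    count P                                            ∎
    where
    open ≤-Reasoning
    in-ball : All (T ∘ P) (tree x x (kOf g))
    in-ball = All.tabulate (near⇒P ∘ tree-near (kOf g))

  moore-even : odd g ≡ false → 2 * kOf g + 1 < g → ∀ {x y} → Adj G x y → (P : V G → Bool) →
               (∀ {z} → Near x z (kOf g) ⊎ Near y z (kOf g) → T (P z)) → Moore δ g ≤ count P
  moore-even even-g 2k+1<g {x} {y} x~y P near⇒P = begin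
    Moore δ g                                          ≡⟨ Moore-even {δ} {g} even-g ⟩
    2 + sumFrom 1 (kOf g) (λ i → 2 * (δ ∸ 1) ^ i)      ≤⟨ even-ball-length (kOf g) x y ⟩
    length (tree y x (kOf g) ++ tree x y (kOf g))      ≤⟨ length≤count P (even-ball-unique (kOf g) x~y 2k+1<g) (All.tabulate in-ball) ⟩
    count P                                            ∎
    where
    open ≤-Reasoning
    in-ball : ∀ {z} → z ∈ tree y x (kOf g) ++ tree x y (kOf g) → T (P z)
    in-ball z∈ = near⇒P ([ inj₁ ∘ tree-near (kOf g) , inj₂ ∘ tree-near (kOf g) ]′ (∈-++⁻ (tree y x (kOf g)) z∈))

-- Equatorial graphs

module Equator (G : Graph) (δ g q : ℕ) (EQ : Equatorial G δ g q) where
  open Equatorial EQ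
  open Walks G

  k K : ℕ
  k = kOf g
  K = 2 * k

  C : Cycle G q
  C = proj₁ (proj₁ equator)

  open OnCycle C
  open Arcs q
  open Rigidity q
  open Moore-bound G δ g (proj₂ mindeg) (proj₂ girth)

  girth-parity : Parity g k
  girth-parity = parity g (≤-trans (s≤s z≤n) g≥3)

  instance
    K-nonZero : NonZero K
    K-nonZero = >-nonZero (≤-trans (k≥1 girth-parity g≥3) (m≤m+n k _))

  room-even : 3 * suc K < q
  room-even = subst (_< q) (identity k) q-big
    where
    identity : ∀ k → 6 * k + 3 ≡ 3 * suc (2 * k)
    identity = solve-∀

  room-odd : 3 * K < q
  room-odd = ≤-<-trans (*-monoʳ-≤ 3 (n≤1+n K)) room-even

  room-pred : 3 * pred K < q
  room-pred = ≤-<-trans (*-monoʳ-≤ 3 (pred[n]≤n {K})) room-odd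

  room-rigid : ∀ {e} → e ≤ 1 → 2 * e + 3 * K < q
  room-rigid e≤1 = ≤-<-trans (≤-trans (+-monoˡ-≤ (3 * K) (*-monoʳ-≤ 2 e≤1)) (≤-trans (n≤1+n _) (≤-reflexive (identity K))))
                             room-even
    where
    identity : ∀ K → suc (2 * 1 + 3 * K) ≡ 3 * suc K
    identity = solve-∀

  K+K<q : K + K < q
  K+K<q = ≤-<-trans (+-monoʳ-≤ K (m≤m+n K _)) room-odd

  k+k<q : k + k < q
  k+k<q = ≤-<-trans (≤-trans (+-monoʳ-≤ k (m≤m+n k 0)) (m≤m+n K K)) K+K<q

  toℕ-mod≈ : ∀ a → toℕ (a mod q) ≈ a
  toℕ-mod≈ a = trans (cong (_% q) (toℕ-mod a)) (%≈ a)

  pos-dist : ∀ a b → Dist G (pos a) (pos b) (cd a b)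
  pos-dist a b = subst (Dist G (pos a) (pos b)) (trans (sym (cd-toℕ (a mod q) (b mod q))) (cd-resp (toℕ-mod≈ a) (toℕ-mod≈ b)))
                       (proj₂ (proj₁ equator) (a mod q) (b mod q))

  pos-near : ∀ {a b e} → Near (pos a) (pos b) e → cd a b ≤ e
  pos-near {a} {b} = Dist≤Near (pos-dist a b)

  around-near : ∀ a b → Near (pos a) (pos b) (cd a b)
  around-near a b = Dist⇒Near (pos-dist a b)

  cd-triangle : ∀ a b c → cd a c ≤ cd a b + cd b c
  cd-triangle a b c = pos-near (near-trans (around-near a b) (around-near b c))

  cd-suc : ∀ a → cd a (suc a) ≤ 1
  cd-suc a = pos-near (1 , ≤-refl , cons (pos-adj a) nil)

  Seen : V G → ℕ → Set
  Seen w a = Near (pos a) w k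

  seenᵇ : V G → ℕ → Bool
  seenᵇ w a = isYes (near? (pos a) w k)

  seen-resp : ∀ {w a a′} → a ≈ a′ → Seen w a → Seen w a′
  seen-resp {w} a≈a′ = subst (λ x → Near x w k) (pos-resp a≈a′)

  seen-mod : ∀ {w a} → Seen w a → Seen w (toℕ (a mod q))
  seen-mod {w} {a} = seen-resp (sym (toℕ-mod≈ a))

  Antipodal : V G → Set
  Antipodal w = Σ[ i ∈ Fin q ] Σ[ j ∈ Fin q ] Seen w (toℕ i) × Seen w (toℕ j) × cd (toℕ i) (toℕ j) ≡ K

  antipodal? : ∀ w → Dec (Antipodal w)
  antipodal? w = Finₚ.any? λ i → Finₚ.any? λ j →
    near? (pos (toℕ i)) w k ×-dec near? (pos (toℕ j)) w k ×-dec cd (toℕ i) (toℕ j) ≟ K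

  SeenWithin : V G → ℕ → Set
  SeenWithin w E = ∀ {a b} → Seen w a → Seen w b → cd a b ≤ E

  seen-within : ∀ w → SeenWithin w K
  seen-within w {a} {b} sa sb = subst (cd a b ≤_) (cong (k +_) (sym (+-identityʳ k))) (pos-near (near-trans sa (near-sym sb)))

  seen-within-pred : ∀ {w} → ¬ Antipodal w → SeenWithin w (pred K)
  seen-within-pred {w} ¬antipodal {a} {b} sa sb = <⇒≤pred (≤∧≢⇒< (seen-within w sa sb) λ cd≡K →
    ¬antipodal (a mod q , b mod q , seen-mod sa , seen-mod sb , trans (cd-resp (toℕ-mod≈ a) (toℕ-mod≈ b)) cd≡K))

  seen-within-edge : ∀ {w E} → SeenWithin w E → ∀ {a b} → Seen w a ⊎ Seen w (suc a) → Seen w b ⊎ Seen w (suc b) →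
                     cd a b ≤ suc E
  seen-within-edge within         (inj₁ sa)  (inj₁ sb)  = m≤n⇒m≤1+n (within sa sb)
  seen-within-edge within {a} {b} (inj₂ sa′) (inj₂ sb′) = m≤n⇒m≤1+n (subst (_≤ _) (cd-shiftˡ 1 a b) (within sa′ sb′))
  seen-within-edge within {a} {b} (inj₂ sa′) (inj₁ sb)  =
    ≤-trans (cd-triangle a (suc a) b) (+-mono-≤ (cd-suc a) (within sa′ sb))
  seen-within-edge {E = E} within {a} {b} (inj₁ sa)  (inj₂ sb′) =
    ≤-trans (cd-triangle a (suc b) b) (subst (cd a (suc b) + cd (suc b) b ≤_) (+-comm E 1)
      (+-mono-≤ (within sa sb′) (subst (_≤ 1) (cd-sym b (suc b)) (cd-suc b))))

  odd-ball : V G → Fin q → Bool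
  odd-ball w i = seenᵇ w (toℕ i)

  odd-row : ∀ {w E} → SeenWithin w E → 3 * E < q → count (odd-ball w) ≤ suc E
  odd-row {w} {E} within room = arc-count (odd-ball w) E room (λ i j Pi Pj → within (toWitness Pi) (toWitness Pj))

  odd-column : odd g ≡ true → g ≡ 1 + K → ∀ i → Moore δ g ≤ count (λ w → odd-ball w i)
  odd-column odd-g g≡ i = moore-odd odd-g (subst (K <_) (sym g≡) ≤-refl) (pos (toℕ i)) _ fromWitness

  even-ball : V G → Fin q → Bool
  even-ball w i = seenᵇ w (toℕ i) ∨ seenᵇ w (suc (toℕ i))

  even-row : ∀ {w E} → SeenWithin w E → 3 * suc E < q → count (even-ball w) ≤ suc (suc E)
  even-row {w} {E} within room = arc-count (even-ball w) (suc E) room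
    (λ i j Pi Pj → seen-within-edge within (seen-edge Pi) (seen-edge Pj))
    where
    seen-edge : ∀ {i} → T (even-ball w i) → Seen w (toℕ i) ⊎ Seen w (suc (toℕ i))
    seen-edge {i} = Sum.map toWitness toWitness ∘ Equivalence.to (T-∨ {seenᵇ w (toℕ i)})

  even-column : odd g ≡ false → g ≡ 2 + K → ∀ i → Moore δ g ≤ count (λ w → even-ball w i)
  even-column even-g g≡ i = moore-even even-g (subst (K + 1 <_) (sym g≡) (≤-reflexive (cong suc (+-comm K 1)))) (pos-adj (toℕ i)) _
    (λ {z} → Equivalence.from (T-∨ {seenᵇ z (toℕ i)}) ∘ Sum.map fromWitness fromWitness)

  odd-row-≤g : g ≡ 1 + K → ∀ w → count (odd-ball w) ≤ g
  odd-row-≤g g≡ w = subst (count (odd-ball w) ≤_) (sym g≡) (odd-row (seen-within w) room-odd)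

  odd-row-<g : g ≡ 1 + K → ∀ {w} → ¬ Antipodal w → count (odd-ball w) < g
  odd-row-<g g≡ ¬antipodal = ≤-<-trans (odd-row (seen-within-pred ¬antipodal) room-pred)
                                       (subst (suc (pred K) <_) (sym g≡) (s≤s (≤-reflexive (suc-pred K))))

  even-row-≤g : g ≡ 2 + K → ∀ w → count (even-ball w) ≤ g
  even-row-≤g g≡ w = subst (count (even-ball w) ≤_) (sym g≡) (even-row (seen-within w) room-even)

  even-row-<g : g ≡ 2 + K → ∀ {w} → ¬ Antipodal w → count (even-ball w) < g
  even-row-<g g≡ ¬antipodal = ≤-<-trans (even-row (seen-within-pred ¬antipodal) (subst (λ E → 3 * E < q) (sym (suc-pred K)) room-odd))
                                        (subst (suc (suc (pred K)) <_) (sym g≡) (s≤s (s≤s (≤-reflexive (suc-pred K)))))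

  every-vertex-antipodal : ∀ w → Antipodal w
  every-vertex-antipodal w with antipodal? w | girth-parity
  ... | yes antipodal | _                      = antipodal
  ... | no ¬antipodal | odd-girth  odd-g  g≡ =
    contradiction (double-counting odd-ball order (odd-column odd-g g≡) (odd-row-≤g g≡) w) (<⇒≱ (odd-row-<g g≡ ¬antipodal))
  ... | no ¬antipodal | even-girth even-g g≡ =
    contradiction (double-counting even-ball order (even-column even-g g≡) (even-row-≤g g≡) w) (<⇒≱ (even-row-<g g≡ ¬antipodal))

  Anchor : V G → ℕ → Set
  Anchor w b = Seen w b × Seen w (b + K)

  anchor-resp : ∀ {w b b′} → b ≈ b′ → Anchor w b → Anchor w b′
  anchor-resp b≈b′ (s₀ , s₁) = seen-resp b≈b′ s₀ , seen-resp (≈-+ʳ K b≈b′) s₁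

  antipodal⇒anchor : ∀ {w a b} → Seen w a → Seen w b → cd a b ≡ K → ∃ (Anchor w)
  antipodal⇒anchor {a = a} {b} sa sb cd≡K with ⊓-sel (off a b) (off b a)
  ... | inj₁ cd≡t = a , sa , seen-resp (sym (off≡⇒≈ a b (trans (sym cd≡t) cd≡K))) sb
  ... | inj₂ cd≡u = b , sb , seen-resp (sym (off≡⇒≈ b a (trans (sym cd≡u) cd≡K))) sa

  anchor : ∀ w → ∃ (Anchor w)
  anchor w = let i , j , si , sj , cd≡K = every-vertex-antipodal w in antipodal⇒anchor si sj cd≡K

  anchor-pos : ∀ {a x} → a + k ≈ x → Anchor (pos x) a
  anchor-pos {a} {x} a+k≈x = near-weaken (≤-reflexive cd≡k) (around-near a x) ,
                             near-weaken (≤-reflexive (trans (cd-sym (a + K) x) cd≡k′)) (around-near (a + K) x)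
    where
    cd≡k : cd a x ≡ k
    cd≡k = trans (cd-resp refl (sym a+k≈x)) (cd-+-short a k+k<q)
    cd≡k′ : cd x (a + K) ≡ k
    cd≡k′ = trans (cd-resp (sym a+k≈x) (≡⇒≈ (trans (cong (a +_) (cong (k +_) (+-identityʳ k))) (sym (+-assoc a k k)))))
                  (cd-+-short (a + k) k+k<q)

  anchor-step : ∀ {w w′ b b′ e} → e ≤ 1 → Anchor w b → Anchor w′ b′ → Near w w′ e → cd b b′ ≤ e
  anchor-step {w} {w′} {e = e} e≤1 (s₀ , s₁) (s₀′ , s₁′) w~w′ =
    rigid (room-rigid e≤1) (via s₀ s₀′) (via s₀ s₁′) (via s₁ s₀′)
    where
    via : ∀ {a a′} → Seen w a → Seen w′ a′ → cd a a′ ≤ e + K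
    via {a} {a′} sa sa′ = subst (cd a a′ ≤_) (identity k e) (pos-near (near-trans sa (near-trans w~w′ (near-sym sa′))))
      where
      identity : ∀ k e → k + (e + k) ≡ e + 2 * k
      identity = solve-∀

  anchor-lipschitz : ∀ {w w′ b b′ l} → Anchor w b → Anchor w′ b′ → Walk G w w′ l → cd b b′ ≤ l
  anchor-lipschitz A A′ nil = anchor-step z≤n A A′ near-refl
  anchor-lipschitz {b = b} {b′} A A′ (cons {y = u} w~u walk) = let c , Aᵤ = anchor u in
    ≤-trans (cd-triangle b c b′) (+-mono-≤ (anchor-step ≤-refl A Aᵤ (1 , ≤-refl , cons w~u nil)) (anchor-lipschitz Aᵤ A′ walk))

  module Reroute {v b} (A : Anchor v b) where

    near₁ : Near (pos b) v k
    near₁ = proj₁ A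

    near₂ : Near v (pos (b + K)) k
    near₂ = near-sym (proj₂ A)

    l₁ l₂ : ℕ
    l₁ = proj₁ near₁
    l₂ = proj₁ near₂

    l₁≤k : l₁ ≤ k
    l₁≤k = proj₁ (proj₂ near₁)

    l₂≤k : l₂ ≤ k
    l₂≤k = proj₁ (proj₂ near₂)

    W₁ : Walk G (pos b) v l₁
    W₁ = proj₂ (proj₂ near₁)

    W₂ : Walk G v (pos (b + K)) l₂
    W₂ = proj₂ (proj₂ near₂)

    W : Walk G (pos b) (pos (b + K)) (l₁ + l₂)
    W = W₁ ++ʷ W₂

    k+k≡K : k + k ≡ K
    k+k≡K = cong (k +_) (sym (+-identityʳ k))

    K≤l₁+l₂ : K ≤ l₁ + l₂
    K≤l₁+l₂ = subst (_≤ l₁ + l₂) (cd-+-short b K+K<q) (Dist≤Near (pos-dist b (b + K)) (l₁ + l₂ , ≤-refl , W))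

    l₁+l₂≡K : l₁ + l₂ ≡ K
    l₁+l₂≡K = ≤-antisym (subst (l₁ + l₂ ≤_) k+k≡K (+-mono-≤ l₁≤k l₂≤k)) K≤l₁+l₂

    l₁≡k : l₁ ≡ k
    l₁≡k = ≤-antisym l₁≤k (+-cancelʳ-≤ k k l₁ (≤-trans (subst (_≤ l₁ + l₂) (sym k+k≡K) K≤l₁+l₂) (+-monoʳ-≤ l₁ l₂≤k)))

    P : ℕ → V G
    P = vertexAt W

    P-k : P k ≡ v
    P-k = subst (λ s → P s ≡ v) l₁≡k (vertexAt-++ W₁ W₂)

    P-K : P K ≡ pos (b + K)
    P-K = trans (cong P (sym l₁+l₂≡K)) (vertexAt-end W)

    -- o ≈ b - k is an anchor of pos b, and Y i below has anchor o + i.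
    o : ℕ
    o = b + (q ∸ k)

    o+k≈b : o + k ≈ b
    o+k≈b = trans (≡⇒≈ (trans (+-assoc b (q ∸ k) k) (cong (b +_) (m∸n+n≡m (≤-trans (m≤m+n k k) (<⇒≤ k+k<q)))))) (+q≈ b)

    anchor-P : ∀ {s c} → s ≤ K → Anchor (P s) c → c ≈ o + s
    anchor-P {s} {c} s≤K Aₛ = locate K+K<q s≤K before after
      where
      s≤l : s ≤ l₁ + l₂
      s≤l = subst (s ≤_) (sym l₁+l₂≡K) s≤K
      before : cd o c ≤ s
      before = anchor-lipschitz (anchor-pos o+k≈b) Aₛ (takeʷ W s s≤l)
      after : cd c (o + K) ≤ K ∸ s
      after = subst (cd c (o + K) ≤_) (cong (_∸ s) l₁+l₂≡K)
        (anchor-lipschitz Aₛ (anchor-pos (trans (≡⇒≈ (xy∙z≈xz∙y o K k)) (≈-+ʳ K o+k≈b))) (dropʷ W s s≤l))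

    P-anchor : ∀ s → s ≤ K → Anchor (P s) (o + s)
    P-anchor s s≤K = let _ , Aₛ = anchor (P s) in anchor-resp (anchor-P s≤K Aₛ) Aₛ

    splice : ∀ s → Dec (s ≤ K) → V G
    splice s (yes _) = P s
    splice s (no  _) = pos (b + s)

    Y : Fin q → V G
    Y i = splice (toℕ i) (toℕ i ≤? K)

    splice-yes : ∀ {s} → s ≤ K → splice s (s ≤? K) ≡ P s
    splice-yes {s} s≤K with s ≤? K
    ... | yes _   = refl
    ... | no  s≰K = contradiction s≤K s≰K

    splice-no : ∀ {s} → ¬ s ≤ K → splice s (s ≤? K) ≡ pos (b + s)
    splice-no {s} s≰K with s ≤? K
    ... | yes s≤K = contradiction s≤K s≰K
    ... | no  _   = refl

    splice-anchor : ∀ s d → Anchor (splice s d) (o + s)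
    splice-anchor s (yes s≤K) = P-anchor s s≤K
    splice-anchor s (no  _)   = anchor-pos (trans (≡⇒≈ (xy∙z≈xz∙y o s k)) (≈-+ʳ s o+k≈b))

    edge : ∀ s → Adj G (pos (b + s)) (pos (b + suc s))
    edge s = subst (λ x → Adj G (pos (b + s)) (pos x)) (sym (+-suc b s)) (pos-adj (b + s))

    splice-adj : ∀ s d d′ → Adj G (splice s d) (splice (suc s) d′)
    splice-adj s (yes _)   (yes 1+s≤K) = vertexAt-adj W s (subst (s <_) (sym l₁+l₂≡K) 1+s≤K)
    splice-adj s (yes s≤K) (no  1+s≰K) = subst (λ x → Adj G x (pos (b + suc s))) (sym P-s) (edge s)
      where
      P-s : P s ≡ pos (b + s)
      P-s = subst (λ s → P s ≡ pos (b + s)) (sym (≤-antisym s≤K (≤-pred (≰⇒> 1+s≰K)))) P-K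
    splice-adj s (no  s≰K) (yes 1+s≤K) = contradiction (≤-trans (n≤1+n s) 1+s≤K) s≰K
    splice-adj s (no  _)   (no  _)     = edge s

    Y-step : ∀ (i j : Fin q) → suc (toℕ i) ≡ toℕ j → Adj G (Y i) (Y j)
    Y-step i j 1+i≡j = subst (Adj G (Y i)) (cong (λ s → splice s (s ≤? K)) 1+i≡j) (splice-adj (toℕ i) (toℕ i ≤? K) (suc (toℕ i) ≤? K))

    Y-close : ∀ (i j : Fin q) → suc (toℕ i) ≡ q → toℕ j ≡ 0 → Adj G (Y i) (Y j)
    Y-close i j 1+i≡q j≡0 =
      subst₂ (Adj G) (sym (splice-no i≰K)) (sym Y-j) (subst (Adj G (pos (b + toℕ i))) (pos-resp wrap) (pos-adj (b + toℕ i)))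
      where
      i≰K : ¬ toℕ i ≤ K
      i≰K i≤K = <⇒≱ (≤-<-trans (m≤m+n (suc K) _) room-even) (subst (_≤ suc K) 1+i≡q (s≤s i≤K))
      wrap : suc (b + toℕ i) ≈ b
      wrap = trans (≡⇒≈ (trans (sym (+-suc b (toℕ i))) (cong (b +_) 1+i≡q))) (+q≈ b)
      Y-j : Y j ≡ pos b
      Y-j = trans (cong (λ s → splice s (s ≤? K)) j≡0) (trans (splice-yes z≤n) (vertexAt-start W))

    Y-anchor : ∀ i → Anchor (Y i) (o + toℕ i)
    Y-anchor i = splice-anchor (toℕ i) (toℕ i ≤? K)

    Y-lower : ∀ i j l → Walk G (Y i) (Y j) l → cycDist q i j ≤ l
    Y-lower i j l walk = subst (_≤ l) (trans (cd-shiftˡ o (toℕ i) (toℕ j)) (cd-toℕ i j)) (anchor-lipschitz (Y-anchor i) (Y-anchor j) walk)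

    Y-injective : ∀ {i j} → Y i ≡ Y j → i ≡ j
    Y-injective {i} {j} Yi≡Yj = Finₚ.toℕ-injective (≈⇒≡ (Finₚ.toℕ<n i) (Finₚ.toℕ<n j) (cd≡0⇒≈ (toℕ i) (toℕ j) cd≡0))
      where
      cd≡0 : cd (toℕ i) (toℕ j) ≡ 0
      cd≡0 = trans (cd-toℕ i j) (n≤0⇒n≡0 (Y-lower i j 0 (subst (λ y → Walk G (Y i) y 0) Yi≡Yj nil)))

    rerouted : Cycle G q
    rerouted = record { len≥3 = len≥3 C ; vtx = Y ; inj = Y-injective ; step = Y-step ; close = Y-close }

    rerouted-isometric : Isometric rerouted
    rerouted-isometric i j = OnCycle.around-toℕ rerouted i j , Y-lower i j

    v∈rerouted : Σ (Fin q) λ i → vtx rerouted i ≡ v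
    v∈rerouted = fromℕ< k<q , trans (cong (λ s → splice s (s ≤? K)) (Finₚ.toℕ-fromℕ< k<q)) (trans (splice-yes (m≤m+n k _)) P-k)
      where
      k<q : k < q
      k<q = ≤-<-trans (m≤m+n k k) k+k<q

proposition19 : (G : Graph) (δ g q : ℕ) → Equatorial G δ g q →
    ∀ (v : V G) → Σ (Cycle G q) λ C → Isometric C × Σ (Fin q) λ i → vtx C i ≡ v
proposition19 G δ g q EQ v = rerouted , rerouted-isometric , v∈rerouted
  where open Equator G δ g q EQ
        open Reroute (proj₂ (anchor v))
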